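{- The image of $\langle x,y,z\rangle_\rho$ under the map $H^2(G,{\mathbb Z}/p{\mathbb Z})\to H^2(G, V_y)$ is given by $x\cup w_z- w_x\cup z$, where $w_x = \begin{pmatrix} t_x \\ x\end{pmatrix}$, $w_z = \begin{pmatrix} t_z \\ z\end{pmatrix}$ are lifts (cocycles in $Z^1(G,V_y)$) of $x$ and $z$, and $$\rho(g) = \begin{pmatrix} 1 & x(g) & -t_x(g)+x(g)y(g) & * \\ 0 & 1 & y(g) & t_{z}(g) \\ 0 & 0 & 1 & z(g) \\ 0 & 0 & 0 & 1 \end{pmatrix}.$$
   Context: Let $G$ be a profinite group, $p$ a prime, and $x,y,z\in H^1(G,{\mathbb Z}/p{\mathbb Z})$ with $x\cup y=y\cup z=0$ ($\cup$ = cup product). Let $V_y=({\mathbb Z}/p{\mathbb Z})^2$ with $G$-action $g\mapsto \begin{pmatrix}1 & y(g)\\ 0 & 1\end{pmatrix}$, sitting in $0\to{\mathbb Z}/p{\mathbb Z}\to V_y\to{\mathbb Z}/p{\mathbb Z}\to 0$, and there is a cup product $H^1(G,{\mathbb Z}/p{\mathbb Z})\times H^1(G,V_y)\to H^2(G,V_y)$. A choice of cochains $k_{xy},k_{yz}\in C^1(G,{\mathbb Z}/p{\mathbb Z})$ with $dk_{xy}=-x\cup y$, $dk_{yz}=-y\cup z$ is equivalent to a homomorphism $\rho\colon G\to \overline{U_4}({\mathbb Z}/p{\mathbb Z})$ (unipotent upper triangular $4\times 4$ matrices modulo the center) with entries $x,y,z$ on the superdiagonal and $k_{xy},k_{yz}$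 on the next diagonal; $\langle x,y,z\rangle_\rho\in H^2(G,{\mathbb Z}/p{\mathbb Z})$ is the class of the cocycle $(g,h)\mapsto x(g)k_{yz}(h)+k_{xy}(g)z(h)$, and the Massey product $\langle x,y,z\rangle$ is the set of all such classes. A lift $w_z=(t_z,z)^T$ is a cocycle iff $dt_z=-y\cup z$ (similarly for $w_x$); here one takes $k_{yz}=t_z$ and $k_{xy}=-t_x+xy$. -}

module Defs where

open import Data.Nat using (ℕ)
open import Data.Fin using (Fin)
open import Data.Integer using (ℤ; +_; _+_; _-_; _*_; -_)
open import Data.Integer.Divisibility using (_∣_)
open import Data.Product using (Σ; _×_; _,_; proj₁; proj₂)
open import Data.Unit using (⊤)
open import Relation.Binary.PropositionalEquality using (_≡_)
open import Algebra.Structures using (IsGroup)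

-- A group (propositional equality) together with a fundamental system
-- `IsOpen` of open normal subgroups (subgroups given as predicates),
-- each of finite index, closed under finite intersection, Hausdorff
-- (the intersection is trivial) and complete (G = lim G/N).

record ProfiniteGroup : Set₁ where
  infixl 7 _∙_
  field
    Carrier  : Set
    _∙_      : Carrier → Carrier → Carrier
    ε        : Carrier
    _⁻¹      : Carrier → Carrier
    isGroup  : IsGroup _≡_ _∙_ ε _⁻¹
    IsOpen   : (Carrier → Set) → Set
    open-ε   : ∀ {N} → IsOpen N → N ε
    open-∙   : ∀ {N} → IsOpen N → ∀ {g h} → N g → N h → N (g ∙ h)
    open-⁻¹  : ∀ {N} → IsOpen N → ∀ {g} → N g → N (g ⁻¹)
    open-normal : ∀ {N} → IsOpen N → ∀ g {h} → N h → N (g ∙ h ∙ g ⁻¹)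
    open-finiteIndex : ∀ {N} → IsOpen N →
      Σ ℕ λ n → Σ (Fin n → Carrier) λ r → ∀ g → Σ (Fin n) λ i → N ((r i) ⁻¹ ∙ g)
    open-whole : IsOpen (λ _ → ⊤)
    open-∩   : ∀ {N M} → IsOpen N → IsOpen M → IsOpen (λ g → N g × M g)
    separated : ∀ g → (∀ N → IsOpen N → N g) → g ≡ ε
    complete : (c : ∀ N → IsOpen N → Carrier) →
      (∀ N M (oN : IsOpen N) (oM : IsOpen M) → (∀ g → M g → N g) →
         N ((c N oN) ⁻¹ ∙ c M oM)) →
      Σ Carrier λ g → ∀ N (oN : IsOpen N) → N (g ⁻¹ ∙ c N oN)

-- Z/pZ is represented by ℤ up to congruence mod p.

_≡[_]_ : ℤ → ℕ → ℤ → Set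
a ≡[ p ] b = (+ p) ∣ (a - b)

-- V_y = (Z/p)^2, represented by ℤ × ℤ up to componentwise congruence.
V : Set
V = ℤ × ℤ

_≡V[_]_ : V → ℕ → V → Set
u ≡V[ p ] v = (proj₁ u ≡[ p ] proj₁ v) × (proj₂ u ≡[ p ] proj₂ v)

_+V_ : V → V → V
(a , b) +V (c , d) = (a + c , b + d)

_-V_ : V → V → V
(a , b) -V (c , d) = (a - c , b - d)

_·V_ : ℤ → V → V
s ·V (a , b) = (s * a , s * b)

_V·_ : V → ℤ → V
(a , b) V· s = (a * s , b * s)

module _ (G : ProfiniteGroup) (p : ℕ) where
  open ProfiniteGroup G

  Continuous¹ : (Carrier → ℤ) → Set₁
  Continuous¹ f = Σ (Carrier → Set) λ N → IsOpen N ×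
    (∀ g g' → N (g ⁻¹ ∙ g') → f g ≡[ p ] f g')

  ContinuousV¹ : (Carrier → V) → Set₁
  ContinuousV¹ f = Σ (Carrier → Set) λ N → IsOpen N ×
    (∀ g g' → N (g ⁻¹ ∙ g') → f g ≡V[ p ] f g')

  d¹ : (Carrier → ℤ) → Carrier → Carrier → ℤ
  d¹ k g h = k h - k (g ∙ h) + k g

  Z¹ : (Carrier → ℤ) → Set₁
  Z¹ x = Continuous¹ x × (∀ g h → x (g ∙ h) ≡[ p ] (x g + x h))

  _∪_ : (Carrier → ℤ) → (Carrier → ℤ) → Carrier → Carrier → ℤ
  (a ∪ b) g h = a g * b h

  SameClass² : (Carrier → Carrier → ℤ) → (Carrier → Carrier → ℤ) → Set₁
  SameClass² c c' = Σ (Carrier → ℤ) λ b → Continuous¹ b ×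
    (∀ g h → (c g h - c' g h) ≡[ p ] d¹ b g h)

  Vanishes² : (Carrier → Carrier → ℤ) → Set₁
  Vanishes² c = SameClass² c (λ _ _ → + 0)

  module _ (y : Carrier → ℤ) where
    act : Carrier → V → V
    act g (a , b) = (a + y g * b , b)

    dV¹ : (Carrier → V) → Carrier → Carrier → V
    dV¹ b g h = (act g (b h) -V b (g ∙ h)) +V b g

    ZV¹ : (Carrier → V) → Set₁
    ZV¹ w = ContinuousV¹ w × (∀ g h → w (g ∙ h) ≡V[ p ] (w g +V act g (w h)))

    _∪V_ : (Carrier → ℤ) → (Carrier → V) → Carrier → Carrier → V
    (a ∪V w) g h = a g ·V act g (w h)

    _V∪_ : (Carrier → V) → (Carrier → ℤ) → Carrier → Carrier → V
    (w V∪ a) g h = w g V· a h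

    ι² : (Carrier → Carrier → ℤ) → Carrier → Carrier → V
    ι² c g h = (c g h , + 0)

    SameClassV² : (Carrier → Carrier → V) → (Carrier → Carrier → V) → Set₁
    SameClassV² c c' = Σ (Carrier → V) λ b → ContinuousV¹ b ×
      (∀ g h → (c g h -V c' g h) ≡V[ p ] dV¹ b g h)

  -- the cocycle representing ⟨x,y,z⟩_ρ for ρ with entries x,y,z on the
  -- superdiagonal and k_xy, k_yz on the next diagonal:
  -- (g,h) ↦ x(g) k_yz(h) + k_xy(g) z(h)
  massey : (x z kxy kyz : Carrier → ℤ) → Carrier → Carrier → ℤ
  massey x z kxy kyz g h = x g * kyz h + kxy g * z h

-- The two cochains already agree on the nose: expanding x ∪ w_z − w_x ∪ z with
-- the action g ↦ [[1, y(g)], [0, 1]] gives first entry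
-- x(g)(t_z(h) + y(g)z(h)) − t_x(g)z(h) = x(g)t_z(h) + (−t_x(g) + x(g)y(g))z(h),
-- which is the Massey cocycle, and second entry x(g)z(h) − x(g)z(h) = 0.
-- Hence their difference is the coboundary of the zero cochain; none of the
-- cocycle or vanishing hypotheses are needed.
module Submission where

open import Defs
open import Data.Nat using (ℕ)
open import Data.Nat.Primality using (Prime)
open import Data.Integer using (ℤ; +_; _+_; _-_; _*_; -_)
open import Data.Integer.Properties using (+-inverseʳ; *-zeroʳ)
open import Data.Integer.Tactic.RingSolver using (solve-∀)
import Data.Nat.Divisibility as ℕ
open import Data.Product using (_,_)
open import Data.Unit using (⊤)
open import Relation.Binary.PropositionalEquality
  using (_≡_; refl; sym; cong; cong₂; module ≡-Reasoning)
open ProfiniteGroup using (Carrier)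

0V : V
0V = (+ 0 , + 0)

≡[]-refl : ∀ p a → a ≡[ p ] a
≡[]-refl p a rewrite +-inverseʳ a = p ℕ.∣0

≡⇒≡V[] : ∀ p {u v} → u ≡ v → u ≡V[ p ] v
≡⇒≡V[] p {a , b} refl = ≡[]-refl p a , ≡[]-refl p b

-V-self : ∀ u → u -V u ≡ 0V
-V-self (a , b) = cong₂ _,_ (+-inverseʳ a) (+-inverseʳ b)

module _ (G : ProfiniteGroup) (p : ℕ) (y : Carrier G → ℤ) where

  dV¹-zero : ∀ g h → dV¹ G p y (λ _ → 0V) g h ≡ 0V
  dV¹-zero g h = cong (λ t → (+ 0 + t - + 0 + + 0 , + 0)) (*-zeroʳ (y g))

  continuousV¹-const : ∀ v → ContinuousV¹ G p (λ _ → v)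
  continuousV¹-const v =
    (λ _ → ⊤) , ProfiniteGroup.open-whole G , λ _ _ _ → ≡⇒≡V[] p {v} refl

  sameClassV²-reflexive : ∀ {c c'} → (∀ g h → c g h ≡ c' g h) →
    SameClassV² G p y c c'
  sameClassV²-reflexive {c} {c'} c≡c' =
    (λ _ → 0V) , continuousV¹-const 0V , λ g h → ≡⇒≡V[] p (begin
      c g h -V c' g h            ≡⟨ cong (_-V c' g h) (c≡c' g h) ⟩
      c' g h -V c' g h           ≡⟨ -V-self (c' g h) ⟩
      0V                         ≡⟨ sym (dV¹-zero g h) ⟩
      dV¹ G p y (λ _ → 0V) g h   ∎)
    where open ≡-Reasoning

  ι²-massey≡cup-difference : (x z tx tz : Carrier G → ℤ) → ∀ g h →
    ι² G p y (massey G p x z (λ k → - tx k + x k * y k) tz) g h ≡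
    _-V_ (_∪V_ G p y x (λ k → (tz k , z k)) g h)
         (_V∪_ G p y (λ k → (tx k , x k)) z g h)
  ι²-massey≡cup-difference x z tx tz g h =
    cong₂ _,_ (first-entry (x g) (y g) (tx g) (tz h) (z h))
              (sym (+-inverseʳ (x g * z h)))
    where
    first-entry : ∀ (xg yg txg tzh zh : ℤ) →
      xg * tzh + (- txg + xg * yg) * zh ≡ xg * (tzh + yg * zh) - txg * zh
    first-entry = solve-∀

proposition2p3 : (G : ProfiniteGroup) (p : ℕ) → Prime p →
    (x y z : Carrier G → ℤ) →
    Z¹ G p x → Z¹ G p y → Z¹ G p z →
    Vanishes² G p (_∪_ G p x y) → Vanishes² G p (_∪_ G p y z) →
    (tx tz : Carrier G → ℤ) →
    ZV¹ G p y (λ g → (tx g , x g)) →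
    ZV¹ G p y (λ g → (tz g , z g)) →
    SameClassV² G p y
      (ι² G p y (massey G p x z (λ g → - tx g + x g * y g) tz))
      (λ g h → _-V_ (_∪V_ G p y x (λ k → (tz k , z k)) g h)
                    (_V∪_ G p y (λ k → (tx k , x k)) z g h))
proposition2p3 G p _ x y z _ _ _ _ _ tx tz _ _ =
  sameClassV²-reflexive G p y (ι²-massey≡cup-difference G p y x z tx tz)
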